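{- Let $k\ge 2$ and $n=r+m(k+1)$ with integers $m\ge 0$ and $r\in\{0,1,\ldots,k\}$. Then: (i) if $r=0$, then $L_n^{(k)}\equiv 2(-1)^m\pmod{2^{k-2}}$; (ii) if $r=1$, then $L_n^{(k)}\equiv (4m+1)(-1)^m\pmod{2^{k-1}}$; (iii) if $r=2$, then $L_n^{(k)}\equiv (4m^2+6m+3)(-1)^m\pmod{2^{k}}$; (iv) if $r\ge 3$, then $$L_n^{(k)}\equiv (-1)^m 2^{r-2}\left(4\left(\binom{m+r+1}{m}-\binom{m+r-1}{m-2}\right)-\left(\binom{m+r}{m}-\binom{m+r-2}{m-2}\right)\right)\pmod{2^{k+r-2}}.$$
   Context: For an integer $k\ge 2$, the $k$-Lucas sequence $\{L_n^{(k)}\}$ is defined by $L_{2-k}^{(k)}=\cdots=L_{ -1}^{(k)}=0$, $L_0^{(k)}=2$, $L_1^{(k)}=1$, and $L_n^{(k)}=L_{n-1}^{(k)}+L_{n-2}^{(k)}+\cdots+L_{n-k}^{(k)}$ for all $n\ge 2$. Binomial coefficient convention: $\binom{a}{b}=0$ whenever $a<b$ or one of $a,b$ is negative. -}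

module Defs where

open import Data.Nat using (ℕ; zero; suc; _+_; _*_; _^_)
open import Data.Nat.Combinatorics using (_C_)
open import Data.List using (List; []; _∷_; take)
open import Data.Nat.ListAction using (sum)
open import Data.Integer using (ℤ; +_; -[1+_]; _-_)
open import Data.Integer.Divisibility using (_∣_)

-- lucasWindow k n = [L_n, L_{n-1}, ..., L_0]  (most recent first)
-- The recurrence L_n = L_{n-1} + ... + L_{n-k} (n ≥ 2) sums the k most
-- recent values; indices below 0 contribute 0 (L_{2-k} = ... = L_{-1} = 0),
-- which is exactly what `take k` on the list [L_{n-1},...,L_0] gives.
lucasWindow : ℕ → ℕ → List ℕ
lucasWindow k zero = 2 ∷ []
lucasWindow k (suc zero) = 1 ∷ 2 ∷ []
lucasWindow k (suc (suc n)) =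
  let prev = lucasWindow k (suc n) in sum (take k prev) ∷ prev

headOr0 : List ℕ → ℕ
headOr0 [] = 0
headOr0 (x ∷ _) = x

L : ℕ → ℕ → ℕ
L k n = headOr0 (lucasWindow k n)

-- Binomial coefficient with integer arguments; 0 if either is negative
-- (and 0 when a < b, as for the library's _C_).
binom : ℤ → ℤ → ℕ
binom (+ a) (+ b) = a C b
binom (+ a) -[1+ b ] = 0
binom -[1+ a ] _ = 0

_≈_[mod_] : ℤ → ℤ → ℕ → Set
infix 4 _≈_[mod_]
a ≈ b [mod d ] = (+ d) ∣ (a - b)

{-# OPTIONS --safe #-}
-- Subtracting two consecutive instances of the recurrence gives
-- L_{n+k+1} = 2 L_{n+k} − L_n for all n ≥ 0 (k ≥ 2), while L_{t+2} = 3·2^t for t ≤ k−2.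
-- For n = r + m(k+1) this makes x(r,m) = (−1)^m L_n satisfy the Pascal-type rule
-- x(r+1,m+1) = 2 x(r,m+1) + x(r+1,m), and x(0,m+1) = x(0,m) − 2 x(k,m).
-- Induction on m and then r shows x(r,m) ≡ G(r,m) (mod 2^{k+r−2}), where G obeys the same
-- rule with G(0,m) = 2 and G(r,0) = L_r: the factor 2 makes the modulus grow with r, and
-- 2^{k−2} ∣ G(k,m) kills the correction in column 0. Explicitly G(1,m) = 4m+1 and
-- G(r,m) = 2^{r−2} (4 E(m,r+1) − E(m,r)) for r ≥ 2, with E(m,b) = C(m+b,m) − C(m+b−2,m−2),
-- because E satisfies Pascal's rule; for r = 2 this is 4m²+6m+3.
module Submission where

open import Defs
open import Data.Nat using (ℕ; zero; suc; _≤_; _<_; _∸_; z≤n; s≤s)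
  renaming (_+_ to _+ℕ_; _*_ to _*ℕ_; _^_ to _^ℕ_)
import Data.Nat.Properties as ℕ
import Data.Nat.Tactic.RingSolver as ℕ-Solver
open import Data.Nat.Divisibility using () renaming (divides to ℕ-divides)
open import Data.Nat.Combinatorics using (_C_; nCk+nC[k+1]≡[n+1]C[k+1]; nCn≡1)
open import Data.Nat.ListAction using (sum)
open import Data.List using (List; []; _∷_; take; drop)
open import Data.List.Properties using (take-[]; drop-[])
open import Data.Integer using (ℤ; +_; -1ℤ; _+_; _-_; _*_; _^_)
import Data.Integer.Properties as ℤ
open import Data.Integer.Divisibility.Signed
  using (_∣_; divides; ∣⇒∣ᵤ; ∣ᵤ⇒∣; ∣-refl; ∣-trans; ∣m∣n⇒∣m+n; ∣m∣n⇒∣m-n; ∣n⇒∣m*n; ∣m⇒∣m*n; *-monoʳ-∣)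
open import Data.Integer.Tactic.RingSolver using (solve-∀)
open import Data.Product using (_×_; _,_)
open import Relation.Binary.PropositionalEquality
  using (_≡_; refl; sym; trans; cong; cong₂; subst; module ≡-Reasoning)

sum-take-suc : ∀ j (xs : List ℕ) → sum (take (suc j) xs) ≡ sum (take j xs) +ℕ headOr0 (drop j xs)
sum-take-suc zero    []       = refl
sum-take-suc (suc j) []       = refl
sum-take-suc zero    (x ∷ xs) = ℕ.+-identityʳ x
sum-take-suc (suc j) (x ∷ xs) =
  trans (cong (x +ℕ_) (sum-take-suc j xs)) (sym (ℕ.+-assoc x _ _))

module _ (k : ℕ) where

  lucasWindow-suc : ∀ n → lucasWindow k (suc n) ≡ L k (suc n) ∷ lucasWindow k n
  lucasWindow-suc zero    = refl
  lucasWindow-suc (suc n) = refl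

  drop-lucasWindow : ∀ j n → drop j (lucasWindow k (j +ℕ n)) ≡ lucasWindow k n
  drop-lucasWindow zero    n = refl
  drop-lucasWindow (suc j) n rewrite lucasWindow-suc (j +ℕ n) = drop-lucasWindow j n

  drop-lucasWindow-short : ∀ j n → n < j → drop j (lucasWindow k n) ≡ []
  drop-lucasWindow-short (suc j) zero    _         = drop-[] j
  drop-lucasWindow-short (suc j) (suc n) (s≤s n<j)
    rewrite lucasWindow-suc n = drop-lucasWindow-short j n n<j

module _ (k' : ℕ) where

  private
    k : ℕ
    k = 2 +ℕ k'

  -- L (3+n) unfolds to L (2+n) + S, where S sums the first k−1 entries of the window
  -- below L (2+n); adding the k-th entry X, the one that has just left the window, to S
  -- gives L (2+n) again.
  L-doubling-window : ∀ n →
    L k (3 +ℕ n) +ℕ headOr0 (drop (suc k') (lucasWindow k (suc n))) ≡ 2 *ℕ L k (2 +ℕ n)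
  L-doubling-window n = begin
    L k (2 +ℕ n) +ℕ S +ℕ X    ≡⟨ ℕ.+-assoc (L k (2 +ℕ n)) S X ⟩
    L k (2 +ℕ n) +ℕ (S +ℕ X)  ≡⟨ cong (L k (2 +ℕ n) +ℕ_) (sym (sum-take-suc (suc k') W)) ⟩
    L k (2 +ℕ n) +ℕ L k (2 +ℕ n) ≡⟨ cong (L k (2 +ℕ n) +ℕ_) (sym (ℕ.+-identityʳ _)) ⟩
    2 *ℕ L k (2 +ℕ n)         ∎
    where
    open ≡-Reasoning
    W : List ℕ
    W = lucasWindow k (suc n)
    S : ℕ
    S = sum (take (suc k') W)
    X : ℕ
    X = headOr0 (drop (suc k') W)

  L-doubling : ∀ n → L k (suc k +ℕ n) +ℕ L k n ≡ 2 *ℕ L k (k +ℕ n)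
  L-doubling n =
    trans (cong (L k (suc k +ℕ n) +ℕ_) (cong headOr0 (sym (drop-lucasWindow k (suc k') n))))
          (L-doubling-window (k' +ℕ n))

  Lℤ-doubling : ∀ n → + L k (suc k +ℕ n) ≡ + 2 * + L k (k +ℕ n) - + L k n
  Lℤ-doubling n = begin
    + a                   ≡⟨ add-sub (+ a) (+ b) ⟩
    + a + + b - + b       ≡⟨ cong (_- + b) (ℤ.pos-+ a b) ⟨
    + (a +ℕ b) - + b      ≡⟨ cong (λ x → + x - + b) (L-doubling n) ⟩
    + (2 *ℕ c) - + b      ≡⟨ cong (_- + b) (ℤ.pos-* 2 c) ⟩
    + 2 * + c - + b       ∎
    where
    open ≡-Reasoning
    a : ℕ
    a = L k (suc k +ℕ n)
    b : ℕ
    b = L k n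
    c : ℕ
    c = L k (k +ℕ n)
    add-sub : ∀ x y → x ≡ x + y - y
    add-sub = solve-∀

  L-doubling-early : ∀ n → n < k' → L k (3 +ℕ n) ≡ 2 *ℕ L k (2 +ℕ n)
  L-doubling-early n n<k' =
    trans (sym (ℕ.+-identityʳ _))
          (trans (cong (λ xs → L k (3 +ℕ n) +ℕ headOr0 xs)
                       (sym (drop-lucasWindow-short k (suc k') (suc n) (s≤s n<k'))))
                 (L-doubling-window n))

  L-initial : ∀ t → t ≤ k' → L k (2 +ℕ t) ≡ 2 ^ℕ t *ℕ 3
  L-initial zero    _      = cong (λ xs → 1 +ℕ (2 +ℕ sum xs)) (take-[] k')
  L-initial (suc t) t<k' = begin
    L k (3 +ℕ t)            ≡⟨ L-doubling-early t t<k' ⟩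
    2 *ℕ L k (2 +ℕ t)       ≡⟨ cong (2 *ℕ_) (L-initial t (ℕ.<⇒≤ t<k')) ⟩
    2 *ℕ (2 ^ℕ t *ℕ 3)      ≡⟨ ℕ.*-assoc 2 (2 ^ℕ t) 3 ⟨
    2 ^ℕ suc t *ℕ 3         ∎
    where open ≡-Reasoning

paths : ℕ → ℕ → ℕ
paths a b = (a +ℕ b) C a

paths-pascal : ∀ a b → paths (suc a) (suc b) ≡ paths a (suc b) +ℕ paths (suc a) b
paths-pascal a b = begin
  suc (a +ℕ suc b) C suc a              ≡⟨ cong (λ n → suc n C suc a) (ℕ.+-suc a b) ⟩
  suc (suc (a +ℕ b)) C suc a            ≡⟨ nCk+nC[k+1]≡[n+1]C[k+1] (suc (a +ℕ b)) a ⟨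
  suc (a +ℕ b) C a +ℕ suc (a +ℕ b) C suc a
    ≡⟨ cong (λ n → n C a +ℕ suc (a +ℕ b) C suc a) (ℕ.+-suc a b) ⟨
  (a +ℕ suc b) C a +ℕ suc (a +ℕ b) C suc a ∎
  where open ≡-Reasoning

paths-zero : ∀ a → paths a 0 ≡ 1
paths-zero a = trans (cong (_C a) (ℕ.+-identityʳ a)) (nCn≡1 a)

paths₋₂ : ℕ → ℕ → ℕ
paths₋₂ (suc (suc a)) b = paths a b
paths₋₂ _             _ = 0

paths₋₂-pascal : ∀ a b → paths₋₂ (suc a) (suc b) ≡ paths₋₂ a (suc b) +ℕ paths₋₂ (suc a) b
paths₋₂-pascal zero          b = refl
paths₋₂-pascal (suc zero)    b = refl
paths₋₂-pascal (suc (suc a)) b = paths-pascal a b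

binomGap : ℕ → ℕ → ℤ
binomGap m b = + paths m b - + paths₋₂ m b

binomGap-pascal : ∀ m b → binomGap (suc m) (suc b) ≡ binomGap m (suc b) + binomGap (suc m) b
binomGap-pascal m b = begin
  + paths (suc m) (suc b) - + paths₋₂ (suc m) (suc b)
    ≡⟨ cong₂ _-_ (trans (cong +_ (paths-pascal m b)) (ℤ.pos-+ p q))
                 (trans (cong +_ (paths₋₂-pascal m b)) (ℤ.pos-+ p₋₂ q₋₂)) ⟩
  (+ p + + q) - (+ p₋₂ + + q₋₂)
    ≡⟨ interchange (+ p) (+ q) (+ p₋₂) (+ q₋₂) ⟩
  binomGap m (suc b) + binomGap (suc m) b ∎
  where
  open ≡-Reasoning
  p : ℕ
  p = paths m (suc b)
  q : ℕ
  q = paths (suc m) b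
  p₋₂ : ℕ
  p₋₂ = paths₋₂ m (suc b)
  q₋₂ : ℕ
  q₋₂ = paths₋₂ (suc m) b
  interchange : ∀ x y u v → (x + y) - (u + v) ≡ (x - u) + (y - v)
  interchange = solve-∀

binomGap-zero : ∀ m → binomGap (2 +ℕ m) 0 ≡ + 0
binomGap-zero m = cong₂ (λ x y → + x - + y) (paths-zero (2 +ℕ m)) (paths-zero m)

binomGap-one : ∀ m → binomGap (suc m) 1 ≡ + 2
binomGap-one zero    = refl
binomGap-one (suc m) =
  trans (binomGap-pascal (suc m) 0) (cong₂ _+_ (binomGap-one m) (binomGap-zero m))

binomGap-two : ∀ m → binomGap m 2 ≡ + 2 * + m + + 1
binomGap-two zero    = refl
binomGap-two (suc m) = begin
  binomGap (suc m) 2                  ≡⟨ binomGap-pascal m 1 ⟩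
  binomGap m 2 + binomGap (suc m) 1   ≡⟨ cong₂ _+_ (binomGap-two m) (binomGap-one m) ⟩
  + 2 * + m + + 1 + + 2               ≡⟨ step (+ m) ⟩
  + 2 * (+ 1 + + m) + + 1             ≡⟨ cong (λ x → + 2 * x + + 1) (ℤ.pos-+ 1 m) ⟨
  + 2 * + suc m + + 1                 ∎
  where
  open ≡-Reasoning
  step : ∀ x → + 2 * x + + 1 + + 2 ≡ + 2 * (+ 1 + x) + + 1
  step = solve-∀

binomGap-three : ∀ m → binomGap m 3 ≡ (+ m + + 1) * (+ m + + 1)
binomGap-three zero    = refl
binomGap-three (suc m) = begin
  binomGap (suc m) 3                  ≡⟨ binomGap-pascal m 2 ⟩
  binomGap m 3 + binomGap (suc m) 2   ≡⟨ cong₂ _+_ (binomGap-three m) (binomGap-two (suc m)) ⟩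
  (+ m + + 1) * (+ m + + 1) + (+ 2 * + suc m + + 1)
    ≡⟨ cong (λ x → (+ m + + 1) * (+ m + + 1) + (+ 2 * x + + 1)) (ℤ.pos-+ 1 m) ⟩
  (+ m + + 1) * (+ m + + 1) + (+ 2 * (+ 1 + + m) + + 1)
    ≡⟨ step (+ m) ⟩
  (+ 1 + + m + + 1) * (+ 1 + + m + + 1)
    ≡⟨ cong (λ x → (x + + 1) * (x + + 1)) (ℤ.pos-+ 1 m) ⟨
  (+ suc m + + 1) * (+ suc m + + 1)   ∎
  where
  open ≡-Reasoning
  step : ∀ x → (x + + 1) * (x + + 1) + (+ 2 * (+ 1 + x) + + 1) ≡ (+ 1 + x + + 1) * (+ 1 + x + + 1)
  step = solve-∀

binomCombo : ℕ → ℕ → ℤ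
binomCombo r m = + 4 * binomGap m (suc r) - binomGap m r

binomCombo-pascal : ∀ r m → binomCombo (suc r) (suc m) ≡ binomCombo r (suc m) + binomCombo (suc r) m
binomCombo-pascal r m =
  trans (cong₂ (λ x y → + 4 * x - y) (binomGap-pascal m (suc r)) (binomGap-pascal m r))
        (regroup (binomGap m (2 +ℕ r)) (binomGap (suc m) (suc r)) (binomGap m (suc r)) (binomGap (suc m) r))
  where
  regroup : ∀ a b c d → + 4 * (a + b) - (c + d) ≡ (+ 4 * b - d) + (+ 4 * a - c)
  regroup = solve-∀

binomCombo-one : ∀ m → binomCombo 1 (suc m) ≡ + 2 * (+ 4 * + suc m + + 1)
binomCombo-one m =
  trans (cong₂ (λ x y → + 4 * x - y) (binomGap-two (suc m)) (binomGap-one m)) (regroup (+ suc m))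
  where
  regroup : ∀ x → + 4 * (+ 2 * x + + 1) - + 2 ≡ + 2 * (+ 4 * x + + 1)
  regroup = solve-∀

binomCombo-two : ∀ m → binomCombo 2 m ≡ + 4 * + m * + m + + 6 * + m + + 3
binomCombo-two m =
  trans (cong₂ (λ x y → + 4 * x - y) (binomGap-three m) (binomGap-two m)) (expand (+ m))
  where
  expand : ∀ x → + 4 * ((x + + 1) * (x + + 1)) - (+ 2 * x + + 1) ≡ + 4 * x * x + + 6 * x + + 3
  expand = solve-∀

-- residue r m is the value of (−1)^m L_{r+m(k+1)} modulo 2^{k+r−2}; it does not depend on k.
residue : ℕ → ℕ → ℤ
residue 0             m = + 2
residue 1             m = + 4 * + m + + 1
residue (suc (suc t)) m = + (2 ^ℕ t) * binomCombo (2 +ℕ t) m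

residue-pascal : ∀ r m → residue (suc r) (suc m) ≡ + 2 * residue r (suc m) + residue (suc r) m
residue-pascal zero m =
  trans (cong (λ x → + 4 * x + + 1) (ℤ.pos-+ 1 m)) (regroup (+ m))
  where
  regroup : ∀ x → + 4 * (+ 1 + x) + + 1 ≡ + 2 * + 2 + (+ 4 * x + + 1)
  regroup = solve-∀
residue-pascal (suc zero) m =
  trans (cong (+ 1 *_) (binomCombo-pascal 1 m))
        (trans (cong (λ x → + 1 * (x + binomCombo 2 m)) (binomCombo-one m))
               (regroup (+ 4 * + suc m + + 1) (binomCombo 2 m)))
  where
  regroup : ∀ x y → + 1 * (+ 2 * x + y) ≡ + 2 * x + + 1 * y
  regroup = solve-∀
residue-pascal (suc (suc t)) m =
  trans (cong₂ _*_ (ℤ.pos-* 2 (2 ^ℕ t)) (binomCombo-pascal (2 +ℕ t) m))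
        (trans (regroup (+ (2 ^ℕ t)) (binomCombo (2 +ℕ t) (suc m)) (binomCombo (3 +ℕ t) m))
               (cong (λ x → + 2 * residue (2 +ℕ t) (suc m) + x * binomCombo (3 +ℕ t) m)
                     (sym (ℤ.pos-* 2 (2 ^ℕ t)))))
  where
  regroup : ∀ p a b → (+ 2 * p) * (a + b) ≡ + 2 * (p * a) + (+ 2 * p) * b
  regroup = solve-∀

residue-initial : ∀ k' r → r ≤ 2 +ℕ k' → residue r 0 ≡ + L (2 +ℕ k') r
residue-initial k' zero          _                 = refl
residue-initial k' (suc zero)    _                 = refl
residue-initial k' (suc (suc t)) (s≤s (s≤s t≤k')) =
  trans (sym (ℤ.pos-* (2 ^ℕ t) 3)) (cong +_ (sym (L-initial k' t t≤k')))

residue-two : ∀ m → residue 2 m ≡ + 4 * + m * + m + + 6 * + m + + 3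
residue-two m = trans (ℤ.*-identityˡ (binomCombo 2 m)) (binomCombo-two m)

2^-∣-2^+ : ∀ a b → + (2 ^ℕ b) ∣ + (2 ^ℕ (a +ℕ b))
2^-∣-2^+ a b = ∣ᵤ⇒∣ (ℕ-divides (2 ^ℕ a) (ℕ.^-distribˡ-+-* 2 a b))

2^-∣-double : ∀ n {x} → + (2 ^ℕ n) ∣ x → + (2 ^ℕ suc n) ∣ + 2 * x
2^-∣-double n {x} d∣x = subst (_∣ + 2 * x) (sym (ℤ.pos-* 2 (2 ^ℕ n))) (*-monoʳ-∣ (+ 2) d∣x)

module _ (k' : ℕ) where

  private
    k : ℕ
    k = 2 +ℕ k'

    Lℤ : ℕ → ℤ
    Lℤ n = + L k n

  Lℤ-column₀ : ∀ m →
    Lℤ (suc m *ℕ (k +ℕ 1)) ≡ + 2 * Lℤ (k +ℕ m *ℕ (k +ℕ 1)) - Lℤ (m *ℕ (k +ℕ 1))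
  Lℤ-column₀ m = trans (cong (λ j → Lℤ (j +ℕ m *ℕ (k +ℕ 1))) (ℕ.+-comm k 1))
                       (Lℤ-doubling k' (m *ℕ (k +ℕ 1)))

  Lℤ-pascal : ∀ r m →
    Lℤ (suc r +ℕ suc m *ℕ (k +ℕ 1))
    ≡ + 2 * Lℤ (r +ℕ suc m *ℕ (k +ℕ 1)) - Lℤ (suc r +ℕ m *ℕ (k +ℕ 1))
  Lℤ-pascal r m =
    trans (cong Lℤ (outer-index r k N))
          (trans (Lℤ-doubling k' (suc r +ℕ N))
                 (cong (λ n → + 2 * Lℤ n - Lℤ (suc r +ℕ N)) (inner-index r k N)))
    where
    N : ℕ
    N = m *ℕ (k +ℕ 1)
    outer-index : ∀ r k N → suc r +ℕ ((k +ℕ 1) +ℕ N) ≡ suc k +ℕ (suc r +ℕ N)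
    outer-index = ℕ-Solver.solve-∀
    inner-index : ∀ r k N → k +ℕ (suc r +ℕ N) ≡ r +ℕ ((k +ℕ 1) +ℕ N)
    inner-index = ℕ-Solver.solve-∀

  L≡residue : ∀ m r → r ≤ k →
    + (2 ^ℕ (r +ℕ k')) ∣ Lℤ (r +ℕ m *ℕ (k +ℕ 1)) - residue r m * -1ℤ ^ m
  L≡residue zero r r≤k = subst (+ (2 ^ℕ (r +ℕ k')) ∣_) (sym vanishes) (divides (+ 0) refl)
    where
    vanishes : Lℤ (r +ℕ 0) - residue r 0 * + 1 ≡ + 0
    vanishes = trans (cong₂ (λ n x → Lℤ n - x) (ℕ.+-identityʳ r)
                            (trans (ℤ.*-identityʳ _) (residue-initial k' r r≤k)))
                     (ℤ.+-inverseʳ (Lℤ r))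
  -- residue k m is a multiple of 2^{k−2}, so modulo 2^{k−2} column 0 only changes sign.
  L≡residue (suc m) zero _ =
    subst (+ (2 ^ℕ k') ∣_) (sym rearranged)
          (∣m∣n⇒∣m+n (∣m∣n⇒∣m-n (∣n⇒∣m*n (+ 2) (∣-trans (2^-∣-2^+ k k') (L≡residue m k ℕ.≤-refl)))
                                 (L≡residue m zero z≤n))
                     (∣n⇒∣m*n (+ 2) (∣m⇒∣m*n s (∣m⇒∣m*n (binomCombo k m) ∣-refl))))
    where
    s : ℤ
    s = -1ℤ ^ m
    a : ℤ
    a = Lℤ (k +ℕ m *ℕ (k +ℕ 1))
    b : ℤ
    b = Lℤ (m *ℕ (k +ℕ 1))
    g : ℤ
    g = residue k m
    regroup : ∀ a b g s → (+ 2 * a - b) - + 2 * (-1ℤ * s)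
                         ≡ + 2 * (a - g * s) - (b - + 2 * s) + + 2 * (g * s)
    regroup = solve-∀
    rearranged : Lℤ (suc m *ℕ (k +ℕ 1)) - + 2 * (-1ℤ * s)
               ≡ + 2 * (a - g * s) - (b - + 2 * s) + + 2 * (g * s)
    rearranged = trans (cong (_- + 2 * (-1ℤ * s)) (Lℤ-column₀ m)) (regroup a b g s)
  L≡residue (suc m) (suc r) r<k =
    subst (+ (2 ^ℕ (suc r +ℕ k')) ∣_) (sym rearranged)
          (∣m∣n⇒∣m-n (2^-∣-double (r +ℕ k') (L≡residue (suc m) r (ℕ.<⇒≤ r<k)))
                     (L≡residue m (suc r) r<k))
    where
    s : ℤ
    s = -1ℤ ^ m
    a : ℤ
    a = Lℤ (r +ℕ suc m *ℕ (k +ℕ 1))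
    b : ℤ
    b = Lℤ (suc r +ℕ m *ℕ (k +ℕ 1))
    g : ℤ
    g = residue r (suc m)
    h : ℤ
    h = residue (suc r) m
    regroup : ∀ a b g h s → (+ 2 * a - b) - (+ 2 * g + h) * (-1ℤ * s)
                           ≡ + 2 * (a - g * (-1ℤ * s)) - (b - h * s)
    regroup = solve-∀
    rearranged : Lℤ (suc r +ℕ suc m *ℕ (k +ℕ 1)) - residue (suc r) (suc m) * (-1ℤ * s)
               ≡ + 2 * (a - g * (-1ℤ * s)) - (b - h * s)
    rearranged = trans (cong₂ (λ x y → x - y * (-1ℤ * s)) (Lℤ-pascal r m) (residue-pascal r m))
                       (regroup a b g h s)

binomGap-binom : ∀ m b →
  + binom (+ m + + (2 +ℕ b)) (+ m) - + binom (+ m + + (2 +ℕ b) - + 2) (+ m - + 2) ≡ binomGap m (2 +ℕ b)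
binomGap-binom zero          b = refl
binomGap-binom (suc zero)    b = refl
binomGap-binom (suc (suc m)) b = refl

binomGap-binom-shifted : ∀ m b →
  + binom (+ m + + (2 +ℕ b) + + 1) (+ m) - + binom (+ m + + (2 +ℕ b) - + 1) (+ m - + 2)
  ≡ binomGap m (3 +ℕ b)
binomGap-binom-shifted m b = cong₂ (λ x y → + (x C m) - + y) upper (lower m)
  where
  upper : m +ℕ (2 +ℕ b) +ℕ 1 ≡ m +ℕ (3 +ℕ b)
  upper = trans (ℕ.+-comm _ 1) (sym (ℕ.+-suc m (2 +ℕ b)))
  lower : ∀ m → binom (+ m + + (2 +ℕ b) - + 1) (+ m - + 2) ≡ paths₋₂ m (3 +ℕ b)
  lower zero          = refl
  lower (suc zero)    = refl
  lower (suc (suc m)) = cong (_C m) (sym (ℕ.+-suc m (2 +ℕ b)))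

binomCombo-binom : ∀ t m → let M = + m; R = + (3 +ℕ t) in
  + 4 * (+ binom (M + R + + 1) M - + binom (M + R - + 1) (M - + 2))
    - (+ binom (M + R) M - + binom (M + R - + 2) (M - + 2))
  ≡ binomCombo (3 +ℕ t) m
binomCombo-binom t m =
  cong₂ (λ x y → + 4 * x - y) (binomGap-binom-shifted m (suc t)) (binomGap-binom m (suc t))

∣⇒≈[mod] : ∀ {d e a x y} → d ≡ e → x ≡ y → + d ∣ a - x → a ≈ y [mod e ]
∣⇒≈[mod] refl refl = ∣⇒∣ᵤ

lemma3p1 : (k m r : ℕ) → 2 ≤ k → r ≤ k →
    let n = r +ℕ m *ℕ (k +ℕ 1)
        s = -1ℤ ^ m
        M = + m
        R = + r
    in (r ≡ 0 → + L k n ≈ + 2 * s [mod 2 ^ℕ (k ∸ 2) ])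
     × (r ≡ 1 → + L k n ≈ (+ 4 * M + + 1) * s [mod 2 ^ℕ (k ∸ 1) ])
     × (r ≡ 2 → + L k n ≈ (+ 4 * M * M + + 6 * M + + 3) * s [mod 2 ^ℕ k ])
     × (3 ≤ r → + L k n ≈ s * + (2 ^ℕ (r ∸ 2))
          * (+ 4 * (+ binom (M + R + + 1) M - + binom (M + R - + 1) (M - + 2))
             - (+ binom (M + R) M - + binom (M + R - + 2) (M - + 2)))
          [mod 2 ^ℕ (k +ℕ r ∸ 2) ])
lemma3p1 (suc zero) m r (s≤s ()) _
lemma3p1 (suc (suc k')) m r _ r≤k =
    (λ { refl → ∣⇒∣ᵤ (L≡residue k' m 0 r≤k) })
  , (λ { refl → ∣⇒∣ᵤ (L≡residue k' m 1 r≤k) })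
  , (λ { refl → ∣⇒≈[mod] {a = Lₙ} refl (cong (_* s) (residue-two m)) (L≡residue k' m 2 r≤k) })
  , λ { (s≤s (s≤s (s≤s (z≤n {t})))) →
          ∣⇒≈[mod] {a = Lₙ} (cong (2 ^ℕ_) (ℕ.+-comm r k'))
            (trans (reorder t) (cong (s * + (2 ^ℕ suc t) *_) (sym (binomCombo-binom t m))))
            (L≡residue k' m r r≤k) }
  where
  Lₙ : ℤ
  Lₙ = + L (2 +ℕ k') (r +ℕ m *ℕ (2 +ℕ k' +ℕ 1))
  s : ℤ
  s = -1ℤ ^ m
  reorder : ∀ t → residue (3 +ℕ t) m * s ≡ s * + (2 ^ℕ suc t) * binomCombo (3 +ℕ t) m
  reorder t = trans (ℤ.*-comm (residue (3 +ℕ t) m) s)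
                    (sym (ℤ.*-assoc s (+ (2 ^ℕ suc t)) (binomCombo (3 +ℕ t) m)))
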